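{- Let $n\ge2$. For $j=0,\dots,\lfloor n/2\rfloor$, $$\pi(p_j)=\begin{cases}p_0&\text{if }j=0,\\ p_j-p_{j-1}&\text{if }0<j<\lfloor n/2\rfloor,\\ -p_{\lfloor n/2\rfloor-1}&\text{if }j=\lfloor n/2\rfloor\end{cases}$$ (here the $p$'s on the right are elements of $\mathfrak P_{n-2}$). Consequently $\pi$ maps $\wp_n$ onto $\wp_{n-2}$, with one-dimensional kernel spanned by $\sum_{j=0}^{\lfloor n/2\rfloor}p_j=\sum_{u\in\mathcal S_n}u$.
   Context: For $u\in\mathcal S_m$, $\mathrm{Peak}(u)=\{i\in\{1,\dots,m-1\}:u_{i-1}<u_i>u_{i+1}\}$ with $u_0=0$. $\mathcal F_m$ is the set of subsets of $\{1,\dots,m-1\}$ without two consecutive integers; $P_F=\sum_{\mathrm{Peak}(u)=F}u$; the peak algebra $\mathfrak P_m$ is the span of $\{P_F\}$ in $\mathbb Q\mathcal S_m$ ($\mathfrak P_0=\mathbb Q$). $p_j=\sum_{u\in\mathcal S_m,\#\mathrm{Peak}(u)=j}u$ for $0\le j\le\lfloor m/2\rfloor$, and $\wp_m=\mathrm{Span}\{p_j\}$. For a set $F$ of integers, $F-2=\{f-2:f\in F\}$. $\pi:\mathfrak P_n\to\mathfrak P_{n-2}$ is the linear map with $P_F\mapsto P_{F-2}$ if $1,2\notin F$; $P_F\mapsto-P_{(F\setminus\{1\})-2}$ if $1\in F$; $P_F\mapsto0$ if $2\in F$. -}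

module Defs where

open import Data.Nat using (ℕ; zero; suc; _<ᵇ_; _≡ᵇ_; _∸_; _≤ᵇ_; ⌊_/2⌋)
open import Data.Bool using (Bool; true; false; _∧_; not; if_then_else_)
open import Data.Fin using (Fin; toℕ; fromℕ<)
open import Data.Fin.Permutation using (Permutation′; _⟨$⟩ʳ_)
open import Data.Vec using (Vec; []; _∷_; tabulate; lookup; drop)
open import Data.Vec.Properties using (≡-dec)
open import Data.Bool.Properties using () renaming (_≟_ to _≟B_)
open import Data.List using (List; []; _∷_; map; filter; foldr; _++_; upTo)
open import Data.Rational using (ℚ; 0ℚ; 1ℚ; _+_; _*_; -_)
open import Relation.Nullary using (does)
open import Relation.Binary.PropositionalEquality using (_≡_)
open import Data.Nat.Properties using (_<?_)

-- The group algebra ℚ𝒮ₘ : elements are functions 𝒮ₘ → ℚ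
-- (the coefficient of each permutation); equality is pointwise.

QS : ℕ → Set
QS m = Permutation′ m → ℚ

_≐_ : ∀ {m} → QS m → QS m → Set
x ≐ y = ∀ u → x u ≡ y u

infix 4 _≐_

zeroQS : ∀ {m} → QS m
zeroQS _ = 0ℚ

_⊕_ : ∀ {m} → QS m → QS m → QS m
(x ⊕ y) u = x u + y u

_·_ : ∀ {m} → ℚ → QS m → QS m
(a · x) u = a * x u

⊖_ : ∀ {m} → QS m → QS m
(⊖ x) u = - x u

infixl 6 _⊕_
infixl 7 _·_

sumQS : ∀ {m} → List (QS m) → QS m
sumQS = foldr _⊕_ zeroQS

sumAll : ∀ {m} → QS m
sumAll _ = 1ℚ

-- Sets of integers ⊆ {0,…,m-1} are encoded as Vec Bool m:
-- bit number k (k = 0,…,m-1) says whether the integer k belongs to the set.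

Set′ : ℕ → Set
Set′ m = Vec Bool m

-- value u_i of the permutation u in one-line notation (values 1..m,
-- positions 1..m), with the convention u_0 = 0 (and 0 outside 1..m)
val : ∀ {m} → Permutation′ m → ℕ → ℕ
val {m} u zero = 0
val {m} u (suc i) with i <? m
... | Relation.Nullary.yes p = suc (toℕ (u ⟨$⟩ʳ fromℕ< p))
... | Relation.Nullary.no _  = 0

isPeak : ∀ {m} → Permutation′ m → ℕ → Bool
isPeak u zero = false
isPeak {m} u (suc i) =
  (suc i <ᵇ m) ∧ ((val u i <ᵇ val u (suc i)) ∧ (val u (suc (suc i)) <ᵇ val u (suc i)))

Peak : ∀ {m} → Permutation′ m → Set′ m
Peak u = tabulate (λ k → isPeak u (toℕ k))

card : ∀ {m} → Set′ m → ℕ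
card [] = 0
card (true ∷ bs) = suc (card bs)
card (false ∷ bs) = card bs

noConsec : ∀ {m} → Set′ m → Bool
noConsec [] = true
noConsec (b ∷ []) = true
noConsec (b ∷ c ∷ r) = not (b ∧ c) ∧ noConsec (c ∷ r)

-- F ∈ ℱₘ : F ⊆ {1,…,m-1} (0 ∉ F) without two consecutive integers
inℱ : ∀ {m} → Set′ m → Bool
inℱ [] = true
inℱ (b ∷ bs) = not b ∧ noConsec (b ∷ bs)

allSets : ∀ m → List (Set′ m)
allSets zero = [] ∷ []
allSets (suc m) = map (true ∷_) (allSets m) ++ map (false ∷_) (allSets m)

ℱ : ∀ m → List (Set′ m)
ℱ m = filter (λ F → inℱ F Data.Bool.≟ true) (allSets m)

mem : ∀ {m} → Set′ m → ℕ → Bool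
mem [] i = false
mem (b ∷ bs) zero = b
mem (b ∷ bs) (suc i) = mem bs i

P : ∀ {m} → Set′ m → QS m
P F u = if does (≡-dec _≟B_ (Peak u) F) then 1ℚ else 0ℚ

p : ∀ m → ℕ → QS m
p m j u = if card (Peak u) ≡ᵇ j then 1ℚ else 0ℚ

-- an element of the peak algebra 𝔓ₘ given by coefficients c_F (F ∈ ℱₘ):
-- Σ_{F ∈ ℱₘ} c_F P_F
comb : ∀ m → (Set′ m → ℚ) → QS m
comb m c = sumQS (map (λ F → c F · P F) (ℱ m))

-- an element of ℘ₘ = Span{p_j} given by coefficients a_j :
-- Σ_{j=0}^{⌊m/2⌋} a_j p_j
combp : ∀ m → (ℕ → ℚ) → QS m
combp m a = sumQS (map (λ j → a j · p m j) (upTo (suc ⌊ m /2⌋)))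

-- π : 𝔓_{k+2} → 𝔓_k.  For F ⊆ {0,…,k+1}, F - 2 (after removing 1 when
-- 1 ∈ F, and given 0,2 ∉ F) is obtained by dropping the bits 0 and 1.

πP : ∀ k → Set′ (suc (suc k)) → QS k
πP k F =
  if mem F 2 then zeroQS
  else (if mem F 1 then ⊖ P (drop 2 F) else P (drop 2 F))

πlin : ∀ k → (Set′ (suc (suc k)) → ℚ) → QS k
πlin k c = sumQS (map (λ F → c F · πP k F) (ℱ (suc (suc k))))

{-# OPTIONS --safe #-}
module Submission where

-- Write 12⊕u = 1 2 (u+2) = lift₀ (lift₀ u) and 21⊕u = 2 1 (u+2) = swap u in one-line notation.
-- Their peak sets are Peak(u)+2 and {1} ∪ (Peak(u)+2), and these are exactly the sets F ∈ ℱₙ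
-- with 2 ∉ F and (F ∖ {1}) − 2 = Peak(u), so unwinding π gives (π x)_u = x_{12⊕u} − x_{21⊕u}
-- for every x ∈ 𝔓ₙ.  As the coefficient of Σ aⱼ pⱼ at v is a_{#Peak(v)} and #Peak(21⊕u) =
-- #Peak(u) + 1, this reads π(Σ aⱼ pⱼ) = Σ (aⱼ − aⱼ₊₁) pⱼ.  The formula for π(pⱼ) is the case
-- a = δⱼ; surjectivity follows by solving aⱼ − aⱼ₊₁ = bⱼ with tail sums; and since every peak
-- count 0, …, ⌊k/2⌋ occurs in 𝒮ₖ, the kernel consists of the a constant on 0, …, ⌊n/2⌋.

open import Defs
open import Algebra.Properties.Group as GroupProperties using ()
open import Data.Bool using (Bool; true; false; T; not; _∧_; if_then_else_)
open import Data.Bool.Properties using (T-∧; T-≡) renaming (_≟_ to _≟B_)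
open import Data.Empty using (⊥-elim)
open import Data.Fin as Fin using (Fin; toℕ; fromℕ<)
open import Data.Fin.Patterns using (0F; 1F)
open import Data.Fin.Permutation using (Permutation′; _⟨$⟩ʳ_; lift₀; swap) renaming (id to idₚ)
open import Data.List using (List; []; _∷_; map; filter; _++_; upTo)
open import Data.List.Properties using (map-applyUpTo)
open import Data.Nat using (ℕ; zero; suc; _∸_; _≤_; _<_; _<ᵇ_; _≡ᵇ_; z≤n; s≤s; ⌊_/2⌋)
open import Data.Nat.Properties
  using (_≟_; _<?_; <ᵇ⇒<; <⇒<ᵇ; <-asym; <⇒≢; ≤-<-trans; ≤-trans; n≤1+n; m≤n⇒m≤1+n; ⌊n/2⌋-mono; +-monoʳ-<; +-∸-assoc; suc-injective)
open import Data.Product using (Σ; ∃-syntax; _×_; _,_; proj₁; proj₂; uncurry)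
open import Data.Rational using (ℚ; 0ℚ; 1ℚ; _+_; _-_; _*_; -_)
open import Data.Rational.Properties
  using (+-identityˡ; +-identityʳ; +-assoc; +-comm; +-inverseʳ; *-identityʳ; *-zeroʳ; neg-distribʳ-*; +-0-group)
open import Data.Vec using ([]; _∷_; tabulate)
open import Data.Vec.Properties using (≡-dec; tabulate-cong; ∷-injectiveʳ)
open import Function using (_∘_; id)
open import Function.Bundles using (Equivalence)
open import Relation.Binary.PropositionalEquality using (_≡_; _≢_; refl; sym; trans; cong; cong₂; subst; module ≡-Reasoning)
open import Relation.Nullary using (yes; no)
open import Relation.Nullary.Decidable using (dec-true; dec-false; T?)

open GroupProperties +-0-group using (//-rightDividesʳ; x∙y⁻¹≈ε⇒x≈y)
open Equivalence using (to)
open ≡-Reasoning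

private
  variable
    A B : Set
    m k : ℕ

sumOver : List A → (A → ℚ) → ℚ
sumOver []       h = 0ℚ
sumOver (x ∷ xs) h = h x + sumOver xs h

sumQS-map-apply : (F : A → QS m) (xs : List A) (v : Permutation′ m) →
                  sumQS (map F xs) v ≡ sumOver xs (λ x → F x v)
sumQS-map-apply F []       v = refl
sumQS-map-apply F (x ∷ xs) v = cong (F x v +_) (sumQS-map-apply F xs v)

sumOver-++ : (xs ys : List A) (h : A → ℚ) → sumOver (xs ++ ys) h ≡ sumOver xs h + sumOver ys h
sumOver-++ []       ys h = sym (+-identityˡ _)
sumOver-++ (x ∷ xs) ys h = trans (cong (h x +_) (sumOver-++ xs ys h)) (sym (+-assoc (h x) _ _))

sumOver-map : (f : A → B) (xs : List A) (h : B → ℚ) → sumOver (map f xs) h ≡ sumOver xs (h ∘ f)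
sumOver-map f []       h = refl
sumOver-map f (x ∷ xs) h = cong (h (f x) +_) (sumOver-map f xs h)

sumOver-zero : (xs : List A) {h : A → ℚ} → (∀ x → h x ≡ 0ℚ) → sumOver xs h ≡ 0ℚ
sumOver-zero []       h≡0 = refl
sumOver-zero (x ∷ xs) h≡0 = trans (cong₂ _+_ (h≡0 x) (sumOver-zero xs h≡0)) (+-identityˡ 0ℚ)

sumOver-filter : (b : A → Bool) (xs : List A) (h : A → ℚ) →
                 sumOver (filter (λ x → b x ≟B true) xs) h ≡ sumOver xs (λ x → if b x then h x else 0ℚ)
sumOver-filter b []       h = refl
sumOver-filter b (x ∷ xs) h with b x
... | true  = cong (h x +_) (sumOver-filter b xs h)
... | false = trans (sumOver-filter b xs h) (sym (+-identityˡ _))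

sumOver-allSets-suc : (h : Set′ (suc m) → ℚ) →
  sumOver (allSets (suc m)) h ≡ sumOver (allSets m) (h ∘ (true ∷_)) + sumOver (allSets m) (h ∘ (false ∷_))
sumOver-allSets-suc {m} h =
  trans (sumOver-++ (map (true ∷_) (allSets m)) _ h)
        (cong₂ _+_ (sumOver-map (true ∷_) (allSets m) h) (sumOver-map (false ∷_) (allSets m) h))

sumOver-allSets-single : ∀ m (G : Set′ m) (h : Set′ m → ℚ) → (∀ F → F ≢ G → h F ≡ 0ℚ) →
                         sumOver (allSets m) h ≡ h G
sumOver-allSets-single zero    []      h off = +-identityʳ (h [])
sumOver-allSets-single (suc m) (true ∷ G) h off = begin
  sumOver (allSets (suc m)) h
    ≡⟨ sumOver-allSets-suc h ⟩
  sumOver (allSets m) (h ∘ (true ∷_)) + sumOver (allSets m) (h ∘ (false ∷_))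
    ≡⟨ cong₂ _+_ (sumOver-allSets-single m G _ (λ F F≢G → off (true ∷ F) (F≢G ∘ ∷-injectiveʳ)))
                 (sumOver-zero (allSets m) (λ F → off (false ∷ F) λ ())) ⟩
  h (true ∷ G) + 0ℚ
    ≡⟨ +-identityʳ _ ⟩
  h (true ∷ G) ∎
sumOver-allSets-single (suc m) (false ∷ G) h off = begin
  sumOver (allSets (suc m)) h
    ≡⟨ sumOver-allSets-suc h ⟩
  sumOver (allSets m) (h ∘ (true ∷_)) + sumOver (allSets m) (h ∘ (false ∷_))
    ≡⟨ cong₂ _+_ (sumOver-zero (allSets m) (λ F → off (true ∷ F) λ ()))
                 (sumOver-allSets-single m G _ (λ F F≢G → off (false ∷ F) (F≢G ∘ ∷-injectiveʳ))) ⟩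
  0ℚ + h (false ∷ G)
    ≡⟨ +-identityˡ _ ⟩
  h (false ∷ G) ∎

sumOver-upTo-suc : ∀ n (h : ℕ → ℚ) → sumOver (upTo (suc n)) h ≡ h 0 + sumOver (upTo n) (h ∘ suc)
sumOver-upTo-suc n h =
  cong (h 0 +_) (trans (cong (λ xs → sumOver xs h) (sym (map-applyUpTo id suc n)))
                       (sumOver-map suc (upTo n) h))

sumOver-upTo-single : ∀ n i (h : ℕ → ℚ) → i < n → (∀ j → j ≢ i → h j ≡ 0ℚ) →
                      sumOver (upTo n) h ≡ h i
sumOver-upTo-single (suc n) zero h _ off = begin
  sumOver (upTo (suc n)) h
    ≡⟨ sumOver-upTo-suc n h ⟩
  h 0 + sumOver (upTo n) (h ∘ suc)
    ≡⟨ cong (h 0 +_) (sumOver-zero (upTo n) (λ j → off (suc j) λ ())) ⟩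
  h 0 + 0ℚ
    ≡⟨ +-identityʳ _ ⟩
  h 0 ∎
sumOver-upTo-single (suc n) (suc i) h (s≤s i<n) off = begin
  sumOver (upTo (suc n)) h
    ≡⟨ sumOver-upTo-suc n h ⟩
  h 0 + sumOver (upTo n) (h ∘ suc)
    ≡⟨ cong₂ _+_ (off 0 λ ()) (sumOver-upTo-single n i (h ∘ suc) i<n (λ j j≢i → off (suc j) (j≢i ∘ suc-injective))) ⟩
  0ℚ + h (suc i)
    ≡⟨ +-identityˡ _ ⟩
  h (suc i) ∎

#Peak : Permutation′ m → ℕ
#Peak v = card (Peak v)

val-inRange : (v : Permutation′ m) {i : ℕ} (i<m : i < m) → val v (suc i) ≡ suc (toℕ (v ⟨$⟩ʳ fromℕ< i<m))
val-inRange {m} v {i} i<m with i <? m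
... | yes _   = refl
... | no  i≮m = ⊥-elim (i≮m i<m)

val-positive : (v : Permutation′ m) {i : ℕ} → i < m → 0 < val v (suc i)
val-positive v i<m = subst (0 <_) (sym (val-inRange v i<m)) (s≤s z≤n)

peak⇒localMax : (v : Permutation′ m) (i : ℕ) → T (isPeak v (suc i)) →
                val v i < val v (suc i) × val v (suc (suc i)) < val v (suc i)
peak⇒localMax {m} v i pk =
  let ascent , descent = to (T-∧ {val v i <ᵇ val v (suc i)}) (proj₂ (to (T-∧ {suc i <ᵇ m}) pk))
  in <ᵇ⇒< _ _ ascent , <ᵇ⇒< _ _ descent

isPeak-nonadjacent : (v : Permutation′ m) (i : ℕ) → isPeak v i ∧ isPeak v (suc i) ≡ false
isPeak-nonadjacent v zero    = refl
isPeak-nonadjacent v (suc i) = dec-false (T? _) λ pk →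
  let pkᵢ , pkᵢ₊₁ = to (T-∧ {isPeak v (suc i)}) pk
  in <-asym (proj₂ (peak⇒localMax v i pkᵢ)) (proj₁ (peak⇒localMax v (suc i) pkᵢ₊₁))

noConsec-tabulate : ∀ n (g : ℕ → Bool) → (∀ i → g i ∧ g (suc i) ≡ false) →
                    noConsec (tabulate {n = n} (g ∘ toℕ)) ≡ true
noConsec-tabulate zero          g _  = refl
noConsec-tabulate (suc zero)    g _  = refl
noConsec-tabulate (suc (suc n)) g nc =
  cong₂ (λ b r → not b ∧ r) (nc 0) (noConsec-tabulate (suc n) (g ∘ suc) (nc ∘ suc))

Peak∈ℱ : (v : Permutation′ m) → inℱ (Peak v) ≡ true
Peak∈ℱ {zero}  v = refl
Peak∈ℱ {suc m} v = noConsec-tabulate (suc m) (isPeak v) (isPeak-nonadjacent v)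

noConsec-tail : (G : Set′ m) → noConsec (false ∷ G) ≡ true → noConsec G ≡ true
noConsec-tail []      _  = refl
noConsec-tail (_ ∷ _) nc = nc

inℱ⇒card≤⌊m/2⌋      : (G : Set′ m) → inℱ G ≡ true → card G ≤ ⌊ m /2⌋
noConsec⇒card≤⌈m/2⌉ : (G : Set′ m) → noConsec G ≡ true → card G ≤ ⌊ suc m /2⌋
inℱ⇒card≤⌊m/2⌋ []          _ = z≤n
inℱ⇒card≤⌊m/2⌋ (false ∷ G) G∈ℱ = noConsec⇒card≤⌈m/2⌉ G (noConsec-tail G G∈ℱ)
noConsec⇒card≤⌈m/2⌉ []              _  = z≤n
noConsec⇒card≤⌈m/2⌉ {suc m} (false ∷ G) nc =
  ≤-trans (noConsec⇒card≤⌈m/2⌉ G (noConsec-tail G nc)) (⌊n/2⌋-mono (n≤1+n (suc m)))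
noConsec⇒card≤⌈m/2⌉ (true ∷ [])     _  = s≤s z≤n
noConsec⇒card≤⌈m/2⌉ (true ∷ g ∷ G)  nc = s≤s (inℱ⇒card≤⌊m/2⌋ (g ∷ G) nc)

#Peak≤⌊m/2⌋ : (v : Permutation′ m) → #Peak v ≤ ⌊ m /2⌋
#Peak≤⌊m/2⌋ v = inℱ⇒card≤⌊m/2⌋ (Peak v) (Peak∈ℱ v)

∧-congˡ-T : ∀ b {x y} → (T b → x ≡ y) → b ∧ x ≡ b ∧ y
∧-congˡ-T false _   = refl
∧-congˡ-T true  x≡y = x≡y _

<⇒<ᵇ≡true : ∀ {a b} → a < b → (a <ᵇ b) ≡ true
<⇒<ᵇ≡true = to T-≡ ∘ <⇒<ᵇ

-- v is u shifted up by two, preceded by 1 2 or 2 1 in one-line notation.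
module _ (v : Permutation′ (suc (suc k))) (u : Permutation′ k)
         (v-shift : ∀ i → v ⟨$⟩ʳ Fin.suc (Fin.suc i) ≡ Fin.suc (Fin.suc (u ⟨$⟩ʳ i)))
         (v₁≤1 : toℕ (v ⟨$⟩ʳ 1F) ≤ 1)
         where

  val-shift : ∀ {i} → i < k → val v (suc (suc (suc i))) ≡ suc (suc (val u (suc i)))
  val-shift i<k = begin
    val v (suc (suc (suc _)))                 ≡⟨ val-inRange v (s≤s (s≤s i<k)) ⟩
    suc (toℕ (v ⟨$⟩ʳ fromℕ< (s≤s (s≤s i<k)))) ≡⟨ cong (suc ∘ toℕ) (v-shift (fromℕ< i<k)) ⟩
    suc (suc (suc (toℕ (u ⟨$⟩ʳ fromℕ< i<k)))) ≡⟨ cong (suc ∘ suc) (val-inRange u i<k) ⟨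
    suc (suc (val u (suc _)))                 ∎

  val-head<val-shift : ∀ {i} → i < k → val v 2 < val v (suc (suc (suc i)))
  val-head<val-shift i<k = ≤-<-trans (subst (_≤ 2) (sym (val-inRange v (s≤s (s≤s z≤n)))) (s≤s v₁≤1))
    (subst (2 <_) (sym (val-shift i<k)) (+-monoʳ-< 2 (val-positive u i<k)))

  isPeak-2≡false : isPeak v 2 ≡ false
  isPeak-2≡false = dec-false (T? _) λ pk →
    let 0<k , _ = to (T-∧ {2 <ᵇ suc (suc k)}) pk
    in <-asym (val-head<val-shift (<ᵇ⇒< 0 k 0<k)) (proj₂ (peak⇒localMax v 1 pk))

  ascent-shift : ∀ i → suc i < k →
    (val v (suc (suc i)) <ᵇ suc (suc (val u (suc i)))) ≡ (val u i <ᵇ val u (suc i))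
  ascent-shift zero    1<k = trans (<⇒<ᵇ≡true (subst (val v 2 <_) (val-shift 0<k) (val-head<val-shift 0<k)))
                                   (sym (<⇒<ᵇ≡true (val-positive u 0<k)))
    where 0<k = ≤-trans (s≤s z≤n) 1<k
  ascent-shift (suc i) i+2<k =
    cong (_<ᵇ suc (suc (val u (suc (suc i))))) (val-shift (≤-trans (m≤n⇒m≤1+n (n≤1+n _)) i+2<k))

  isPeak-shift : ∀ i → isPeak v (suc (suc (suc i))) ≡ isPeak u (suc i)
  isPeak-shift i = ∧-congˡ-T (suc i <ᵇ k) (localMax-shift ∘ <ᵇ⇒< _ _)
    where
    localMax-shift : suc i < k →
      (val v (suc (suc i)) <ᵇ val v (suc (suc (suc i)))) ∧ (val v (suc (suc (suc (suc i)))) <ᵇ val v (suc (suc (suc i))))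
      ≡ (val u i <ᵇ val u (suc i)) ∧ (val u (suc (suc i)) <ᵇ val u (suc i))
    localMax-shift i+1<k = begin
      (val v (suc (suc i)) <ᵇ val v (suc (suc (suc i)))) ∧ (val v (suc (suc (suc (suc i)))) <ᵇ val v (suc (suc (suc i))))
        ≡⟨ cong₂ (λ x y → (val v (suc (suc i)) <ᵇ x) ∧ (y <ᵇ x))
                 (val-shift (≤-trans (n≤1+n _) i+1<k)) (val-shift i+1<k) ⟩
      (val v (suc (suc i)) <ᵇ suc (suc (val u (suc i)))) ∧ (val u (suc (suc i)) <ᵇ val u (suc i))
        ≡⟨ cong (_∧ (val u (suc (suc i)) <ᵇ val u (suc i))) (ascent-shift i i+1<k) ⟩
      (val u i <ᵇ val u (suc i)) ∧ (val u (suc (suc i)) <ᵇ val u (suc i)) ∎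

  Peak-shift : Peak v ≡ false ∷ isPeak v 1 ∷ Peak u
  Peak-shift = cong (λ t → false ∷ isPeak v 1 ∷ t) (tabulate-cong shifted)
    where
    shifted : ∀ (j : Fin k) → isPeak v (suc (suc (toℕ j))) ≡ isPeak u (toℕ j)
    shifted 0F           = isPeak-2≡false
    shifted (Fin.suc j)  = isPeak-shift (toℕ j)

Peak-lift₀² : (u : Permutation′ k) → Peak (lift₀ (lift₀ u)) ≡ false ∷ false ∷ Peak u
Peak-lift₀² u = Peak-shift (lift₀ (lift₀ u)) u (λ _ → refl) (s≤s z≤n)

Peak-swap : (u : Permutation′ k) → Peak (swap u) ≡ false ∷ true ∷ Peak u
Peak-swap u = Peak-shift (swap u) u (λ _ → refl) z≤n

P-on-Peak : (v : Permutation′ m) → P (Peak v) v ≡ 1ℚ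
P-on-Peak v = cong (if_then 1ℚ else 0ℚ) (dec-true (≡-dec _≟B_ (Peak v) (Peak v)) refl)

P-off-Peak : (v : Permutation′ m) {F : Set′ m} → F ≢ Peak v → P F v ≡ 0ℚ
P-off-Peak v F≢ = cong (if_then 1ℚ else 0ℚ) (dec-false (≡-dec _≟B_ (Peak v) _) (F≢ ∘ sym))

if-then-0 : ∀ b {x : ℚ} → x ≡ 0ℚ → (if b then x else 0ℚ) ≡ 0ℚ
if-then-0 true  x≡0 = x≡0
if-then-0 false _   = refl

comb-apply : ∀ m (c : Set′ m → ℚ) (v : Permutation′ m) → comb m c v ≡ c (Peak v)
comb-apply m c v = begin
  comb m c v
    ≡⟨ sumQS-map-apply (λ F → c F · P F) (ℱ m) v ⟩
  sumOver (ℱ m) (λ F → c F * P F v)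
    ≡⟨ sumOver-filter inℱ (allSets m) _ ⟩
  sumOver (allSets m) (λ F → if inℱ F then c F * P F v else 0ℚ)
    ≡⟨ sumOver-allSets-single m (Peak v) _ off-Peak ⟩
  (if inℱ (Peak v) then c (Peak v) * P (Peak v) v else 0ℚ)
    ≡⟨ cong (if_then c (Peak v) * P (Peak v) v else 0ℚ) (Peak∈ℱ v) ⟩
  c (Peak v) * P (Peak v) v
    ≡⟨ cong (c (Peak v) *_) (P-on-Peak v) ⟩
  c (Peak v) * 1ℚ
    ≡⟨ *-identityʳ _ ⟩
  c (Peak v) ∎
  where
  off-Peak : ∀ F → F ≢ Peak v → (if inℱ F then c F * P F v else 0ℚ) ≡ 0ℚ
  off-Peak F F≢ = if-then-0 (inℱ F) (trans (cong (c F *_) (P-off-Peak v F≢)) (*-zeroʳ (c F)))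

δ : ℕ → ℕ → ℚ
δ j i = if i ≡ᵇ j then 1ℚ else 0ℚ

δ-off : ∀ {i j} → i ≢ j → δ j i ≡ 0ℚ
δ-off i≢j = cong (if_then 1ℚ else 0ℚ) (dec-false (_ ≟ _) i≢j)

combp-apply : ∀ m (a : ℕ → ℚ) (v : Permutation′ m) → combp m a v ≡ a (#Peak v)
combp-apply m a v = begin
  combp m a v
    ≡⟨ sumQS-map-apply (λ j → a j · p m j) (upTo (suc ⌊ m /2⌋)) v ⟩
  sumOver (upTo (suc ⌊ m /2⌋)) (λ j → a j * δ j (#Peak v))
    ≡⟨ sumOver-upTo-single _ (#Peak v) _ (s≤s (#Peak≤⌊m/2⌋ v)) off-#Peak ⟩
  a (#Peak v) * δ (#Peak v) (#Peak v)
    ≡⟨ cong (λ b → a (#Peak v) * (if b then 1ℚ else 0ℚ)) (dec-true (#Peak v ≟ #Peak v) refl) ⟩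
  a (#Peak v) * 1ℚ
    ≡⟨ *-identityʳ _ ⟩
  a (#Peak v) ∎
  where
  off-#Peak : ∀ j → j ≢ #Peak v → a j * δ j (#Peak v) ≡ 0ℚ
  off-#Peak j j≢ = trans (cong (a j *_) (δ-off (j≢ ∘ sym))) (*-zeroʳ (a j))

comb-card : ∀ m (a : ℕ → ℚ) → comb m (a ∘ card) ≐ combp m a
comb-card m a v = trans (comb-apply m (a ∘ card) v) (sym (combp-apply m a v))

mem-Peak-0 : (u : Permutation′ k) → mem (Peak u) 0 ≡ false
mem-Peak-0 {zero}  u = refl
mem-Peak-0 {suc k} u = refl

πP-off-Peak : ∀ b₀ b₁ {G : Set′ k} (u : Permutation′ k) → G ≢ Peak u → πP k (b₀ ∷ b₁ ∷ G) u ≡ 0ℚ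
πP-off-Peak b₀ b₁ {G} u G≢ with mem G 0 | b₁
... | true  | _     = refl
... | false | true  = cong -_ (P-off-Peak u G≢)
... | false | false = P-off-Peak u G≢

πP-on-Peak : ∀ b₀ b₁ (u : Permutation′ k) → πP k (b₀ ∷ b₁ ∷ Peak u) u ≡ (if b₁ then - 1ℚ else 1ℚ)
πP-on-Peak b₀ b₁ u rewrite mem-Peak-0 u with b₁
... | true  = cong -_ (P-on-Peak u)
... | false = P-on-Peak u

πlin-apply-Peak : ∀ k (c : Set′ (suc (suc k)) → ℚ) (u : Permutation′ k) →
                  πlin k c u ≡ c (false ∷ false ∷ Peak u) - c (false ∷ true ∷ Peak u)
πlin-apply-Peak k c u = begin
  πlin k c u
    ≡⟨ sumQS-map-apply (λ F → c F · πP k F) (ℱ (suc (suc k))) u ⟩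
  sumOver (ℱ (suc (suc k))) (λ F → c F * πP k F u)
    ≡⟨ sumOver-filter inℱ (allSets (suc (suc k))) _ ⟩
  sumOver (allSets (suc (suc k))) h
    ≡⟨ sumOver-allSets-suc h ⟩
  sumOver (allSets (suc k)) (h ∘ (true ∷_)) + sumOver (allSets (suc k)) (h ∘ (false ∷_))
    ≡⟨ cong₂ _+_ (sumOver-zero (allSets (suc k)) λ _ → refl) (sumOver-allSets-suc (h ∘ (false ∷_))) ⟩
  0ℚ + (sumOver (allSets k) (h ∘ (false ∷_) ∘ (true ∷_)) + sumOver (allSets k) (h ∘ (false ∷_) ∘ (false ∷_)))
    ≡⟨ +-identityˡ _ ⟩
  sumOver (allSets k) (h ∘ (false ∷_) ∘ (true ∷_)) + sumOver (allSets k) (h ∘ (false ∷_) ∘ (false ∷_))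
    ≡⟨ cong₂ _+_ (single true) (single false) ⟩
  h (false ∷ true ∷ Peak u) + h (false ∷ false ∷ Peak u)
    ≡⟨ cong₂ _+_ (h-on-Peak (swap u) true (Peak-swap u)) (h-on-Peak (lift₀ (lift₀ u)) false (Peak-lift₀² u)) ⟩
  c₀₁ * - 1ℚ + c₀₀ * 1ℚ
    ≡⟨ cong₂ _+_ (sym (neg-distribʳ-* c₀₁ 1ℚ)) refl ⟩
  - (c₀₁ * 1ℚ) + c₀₀ * 1ℚ
    ≡⟨ cong₂ (λ x y → - x + y) (*-identityʳ c₀₁) (*-identityʳ c₀₀) ⟩
  - c₀₁ + c₀₀
    ≡⟨ +-comm (- c₀₁) c₀₀ ⟩
  c₀₀ - c₀₁ ∎
  where
  c₀₀ = c (false ∷ false ∷ Peak u)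
  c₀₁ = c (false ∷ true ∷ Peak u)

  h : Set′ (suc (suc k)) → ℚ
  h F = if inℱ F then c F * πP k F u else 0ℚ

  single : ∀ b → sumOver (allSets k) (h ∘ (false ∷_) ∘ (b ∷_)) ≡ h (false ∷ b ∷ Peak u)
  single b = sumOver-allSets-single k (Peak u) _ λ G G≢ →
    if-then-0 (inℱ (false ∷ b ∷ G))
              (trans (cong (c (false ∷ b ∷ G) *_) (πP-off-Peak false b u G≢)) (*-zeroʳ (c (false ∷ b ∷ G))))

  h-on-Peak : ∀ (v : Permutation′ (suc (suc k))) b → Peak v ≡ false ∷ b ∷ Peak u →
              h (false ∷ b ∷ Peak u) ≡ c (false ∷ b ∷ Peak u) * (if b then - 1ℚ else 1ℚ)
  h-on-Peak v b Peak-v = begin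
    h (false ∷ b ∷ Peak u)
      ≡⟨ cong (if_then c (false ∷ b ∷ Peak u) * πP k (false ∷ b ∷ Peak u) u else 0ℚ)
              (subst (λ F → inℱ F ≡ true) Peak-v (Peak∈ℱ v)) ⟩
    c (false ∷ b ∷ Peak u) * πP k (false ∷ b ∷ Peak u) u
      ≡⟨ cong (c (false ∷ b ∷ Peak u) *_) (πP-on-Peak false b u) ⟩
    c (false ∷ b ∷ Peak u) * (if b then - 1ℚ else 1ℚ) ∎

πlin-apply : ∀ k (c : Set′ (suc (suc k)) → ℚ) (u : Permutation′ k) →
             πlin k c u ≡ comb (suc (suc k)) c (lift₀ (lift₀ u)) - comb (suc (suc k)) c (swap u)
πlin-apply k c u = begin
  πlin k c u
    ≡⟨ πlin-apply-Peak k c u ⟩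
  c (false ∷ false ∷ Peak u) - c (false ∷ true ∷ Peak u)
    ≡⟨ sym (cong₂ _-_ (cong c (Peak-lift₀² u)) (cong c (Peak-swap u))) ⟩
  c (Peak (lift₀ (lift₀ u))) - c (Peak (swap u))
    ≡⟨ sym (cong₂ _-_ (comb-apply _ c (lift₀ (lift₀ u))) (comb-apply _ c (swap u))) ⟩
  comb (suc (suc k)) c (lift₀ (lift₀ u)) - comb (suc (suc k)) c (swap u) ∎

π-coefficient : (c : Set′ (suc (suc k)) → ℚ) (a : ℕ → ℚ) → comb (suc (suc k)) c ≐ combp (suc (suc k)) a →
                ∀ u → πlin k c u ≡ a (#Peak u) - a (suc (#Peak u))
π-coefficient {k} c a c≐a u = begin
  πlin k c u
    ≡⟨ πlin-apply k c u ⟩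
  comb (suc (suc k)) c (lift₀ (lift₀ u)) - comb (suc (suc k)) c (swap u)
    ≡⟨ cong₂ _-_ (trans (c≐a _) (combp-apply _ a (lift₀ (lift₀ u))))
                 (trans (c≐a _) (combp-apply _ a (swap u))) ⟩
  a (#Peak (lift₀ (lift₀ u))) - a (#Peak (swap u))
    ≡⟨ cong₂ (λ F G → a (card F) - a (card G)) (Peak-lift₀² u) (Peak-swap u) ⟩
  a (#Peak u) - a (suc (#Peak u)) ∎

πlin-combp : (c : Set′ (suc (suc k)) → ℚ) (a : ℕ → ℚ) → comb (suc (suc k)) c ≐ combp (suc (suc k)) a →
             πlin k c ≐ combp k (λ j → a j - a (suc j))
πlin-combp {k} c a c≐a u = trans (π-coefficient c a c≐a u) (sym (combp-apply k (λ j → a j - a (suc j)) u))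

p≐combp-δ : ∀ m j → p m j ≐ combp m (δ j)
p≐combp-δ m j v = sym (combp-apply m (δ j) v)

π-p : (c : Set′ (suc (suc k)) → ℚ) {j : ℕ} → comb (suc (suc k)) c ≐ p (suc (suc k)) j →
      ∀ u → πlin k c u ≡ δ j (#Peak u) - δ j (suc (#Peak u))
π-p c {j} c≐p = π-coefficient c (δ j) λ v → trans (c≐p v) (p≐combp-δ _ j v)

π-p₀ : (c : Set′ (suc (suc k)) → ℚ) → comb (suc (suc k)) c ≐ p (suc (suc k)) 0 → πlin k c ≐ p k 0
π-p₀ c c≐p u = trans (π-p c c≐p u) (+-identityʳ _)

π-p-suc : (c : Set′ (suc (suc k)) → ℚ) {j : ℕ} → comb (suc (suc k)) c ≐ p (suc (suc k)) (suc j) →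
          πlin k c ≐ p k (suc j) ⊕ ⊖ p k j
π-p-suc c c≐p = π-p c c≐p

π-p-top : (c : Set′ (suc (suc k)) → ℚ) → comb (suc (suc k)) c ≐ p (suc (suc k)) (suc ⌊ k /2⌋) →
          πlin k c ≐ ⊖ p k ⌊ k /2⌋
π-p-top {k} c c≐p u = begin
  πlin k c u                                ≡⟨ π-p c c≐p u ⟩
  δ (suc ⌊ k /2⌋) (#Peak u) - p k ⌊ k /2⌋ u ≡⟨ cong (_- p k ⌊ k /2⌋ u) (δ-off (<⇒≢ (s≤s (#Peak≤⌊m/2⌋ u)))) ⟩
  0ℚ - p k ⌊ k /2⌋ u                        ≡⟨ +-identityˡ _ ⟩
  - p k ⌊ k /2⌋ u                           ∎

tailSum : (ℕ → ℚ) → ℕ → ℕ → ℚ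
tailSum b j zero    = 0ℚ
tailSum b j (suc t) = b j + tailSum b (suc j) t

antidifference : (ℕ → ℚ) → ℕ → ℕ → ℚ
antidifference b n j = tailSum b j (suc n ∸ j)

antidifference-step : (b : ℕ → ℚ) {n i : ℕ} → i ≤ n →
                      antidifference b n i - antidifference b n (suc i) ≡ b i
antidifference-step b {n} {i} i≤n = begin
  tailSum b i (suc n ∸ i) - tailSum b (suc i) (n ∸ i)
    ≡⟨ cong (λ t → tailSum b i t - tailSum b (suc i) (n ∸ i)) (+-∸-assoc 1 i≤n) ⟩
  (b i + tailSum b (suc i) (n ∸ i)) - tailSum b (suc i) (n ∸ i)
    ≡⟨ //-rightDividesʳ _ (b i) ⟩
  b i ∎

π-surjective : (b : ℕ → ℚ) → πlin k (antidifference b ⌊ k /2⌋ ∘ card) ≐ combp k b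
π-surjective {k} b u = begin
  πlin k (a ∘ card) u             ≡⟨ π-coefficient (a ∘ card) a (comb-card _ a) u ⟩
  a (#Peak u) - a (suc (#Peak u)) ≡⟨ antidifference-step b (#Peak≤⌊m/2⌋ u) ⟩
  b (#Peak u)                     ≡⟨ combp-apply k b u ⟨
  combp k b u                     ∎
  where
  a = antidifference b ⌊ k /2⌋

∃-#Peak : ∀ m {i} → i ≤ ⌊ m /2⌋ → ∃[ v ] #Peak {m} v ≡ i
∃-#Peak zero          z≤n     = idₚ , refl
∃-#Peak (suc zero)    z≤n     = idₚ , refl
∃-#Peak (suc (suc m)) z≤n     =
  let u , #u≡0 = ∃-#Peak m z≤n in lift₀ (lift₀ u) , trans (cong card (Peak-lift₀² u)) #u≡0
∃-#Peak (suc (suc m)) (s≤s i≤) =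
  let u , #u≡i = ∃-#Peak m i≤ in swap u , trans (cong card (Peak-swap u)) (cong suc #u≡i)

constant-of-steps : (a : ℕ → A) {n : ℕ} → (∀ {i} → i < n → a i ≡ a (suc i)) → ∀ {i} → i ≤ n → a i ≡ a 0
constant-of-steps a step {zero}  _   = refl
constant-of-steps a step {suc i} i<n =
  trans (sym (step i<n)) (constant-of-steps a step (≤-trans (n≤1+n i) i<n))

π-kernel⇒constant : (c : Set′ (suc (suc k)) → ℚ) (a : ℕ → ℚ) → comb (suc (suc k)) c ≐ combp (suc (suc k)) a →
                    πlin k c ≐ zeroQS → combp (suc (suc k)) a ≐ a 0 · sumAll
π-kernel⇒constant {k} c a c≐a πc≐0 v = begin
  combp (suc (suc k)) a v ≡⟨ combp-apply _ a v ⟩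
  a (#Peak v)             ≡⟨ constant-of-steps a step (#Peak≤⌊m/2⌋ v) ⟩
  a 0                     ≡⟨ *-identityʳ (a 0) ⟨
  a 0 * 1ℚ                ∎
  where
  step : ∀ {i} → i < suc ⌊ k /2⌋ → a i ≡ a (suc i)
  step (s≤s i≤) =
    let u , #u≡i = ∃-#Peak k i≤
    in subst (λ i → a i ≡ a (suc i)) #u≡i
             (x∙y⁻¹≈ε⇒x≈y _ _ (trans (sym (π-coefficient c a c≐a u)) (πc≐0 u)))

constant⇒π-kernel : (c : Set′ (suc (suc k)) → ℚ) (a : ℕ → ℚ) → comb (suc (suc k)) c ≐ combp (suc (suc k)) a →
                    ∀ t → combp (suc (suc k)) a ≐ t · sumAll → πlin k c ≐ zeroQS
constant⇒π-kernel {k} c a c≐a t a≐t u = begin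
  πlin k c u
    ≡⟨ πlin-apply k c u ⟩
  comb (suc (suc k)) c (lift₀ (lift₀ u)) - comb (suc (suc k)) c (swap u)
    ≡⟨ cong₂ _-_ (trans (c≐a _) (a≐t _)) (trans (c≐a _) (a≐t _)) ⟩
  t * 1ℚ - t * 1ℚ
    ≡⟨ +-inverseʳ (t * 1ℚ) ⟩
  0ℚ ∎

π-p-formula : ∀ k j (c : Set′ (suc (suc k)) → ℚ) → comb (suc (suc k)) c ≐ p (suc (suc k)) j →
  (j ≡ 0 → πlin k c ≐ p k 0)
  × (0 < j → j < ⌊ suc (suc k) /2⌋ → πlin k c ≐ p k j ⊕ ⊖ p k (j ∸ 1))
  × (j ≡ ⌊ suc (suc k) /2⌋ → πlin k c ≐ ⊖ p k (⌊ suc (suc k) /2⌋ ∸ 1))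
π-p-formula k zero    c c≐p = (λ _ → π-p₀ c c≐p) , (λ ()) , (λ ())
π-p-formula k (suc j) c c≐p = (λ ()) , (λ _ _ → π-p-suc c c≐p) , λ { refl → π-p-top c c≐p }

proposition6p11 : (k : ℕ) →
    ((j : ℕ) → j ≤ ⌊ suc (suc k) /2⌋ →
      Σ (Set′ (suc (suc k)) → ℚ) (λ c → comb (suc (suc k)) c ≐ p (suc (suc k)) j)
      × ((c : Set′ (suc (suc k)) → ℚ) → comb (suc (suc k)) c ≐ p (suc (suc k)) j →
          (j ≡ 0 → πlin k c ≐ p k 0)
          × (0 < j → j < ⌊ suc (suc k) /2⌋ → πlin k c ≐ p k j ⊕ ⊖ p k (j ∸ 1))
          × (j ≡ ⌊ suc (suc k) /2⌋ → πlin k c ≐ ⊖ p k (⌊ suc (suc k) /2⌋ ∸ 1))))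
    × ((c : Set′ (suc (suc k)) → ℚ) → (a : ℕ → ℚ) → comb (suc (suc k)) c ≐ combp (suc (suc k)) a →
        Σ (ℕ → ℚ) (λ b → πlin k c ≐ combp k b))
    × ((b : ℕ → ℚ) → Σ (Set′ (suc (suc k)) → ℚ) (λ c → Σ (ℕ → ℚ) (λ a →
        comb (suc (suc k)) c ≐ combp (suc (suc k)) a × πlin k c ≐ combp k b)))
    × ((c : Set′ (suc (suc k)) → ℚ) → (a : ℕ → ℚ) → comb (suc (suc k)) c ≐ combp (suc (suc k)) a →
        (πlin k c ≐ zeroQS → Σ ℚ (λ t → combp (suc (suc k)) a ≐ t · sumAll))
        × (Σ ℚ (λ t → combp (suc (suc k)) a ≐ t · sumAll) → πlin k c ≐ zeroQS))
    × (combp (suc (suc k)) (λ _ → 1ℚ) ≐ sumAll)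
proposition6p11 k =
    (λ j _ → (δ j ∘ card , comb-apply _ (δ j ∘ card)) , π-p-formula k j)
  , (λ c a c≐a → (λ j → a j - a (suc j)) , πlin-combp c a c≐a)
  , (λ b → let a = antidifference b ⌊ k /2⌋ in a ∘ card , a , comb-card _ a , π-surjective b)
  , (λ c a c≐a → (λ πc≐0 → a 0 , π-kernel⇒constant c a c≐a πc≐0) , uncurry (constant⇒π-kernel c a c≐a))
  , combp-apply _ (λ _ → 1ℚ)
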